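{- Let $X,Y$ be indeterminates and $\theta_n(X,Y)=\mu_n(b_k,\lambda_k)$ with $b_k=2k+X+Y$ ($k\ge0$) and $\lambda_k=(k+X)(k-1+Y)$ ($k\ge1$). Then for every integer $J\ge0$, \[ \sum_{k=0}^J\theta_k(X,Y)\frac{(Y-1)_{J-k}(X)_{J-k}}{(J-k)!}=\frac{(Y)_J(X+1)_J}{J!}. \]
   Context: For sequences $(b_k)_{k\ge0}$, $(\lambda_k)_{k\ge1}$ let $p_n$ be the monic polynomials with $p_{ -1}=0$, $p_0=1$, $p_{n+1}=(x-b_n)p_n-\lambda_np_{n-1}$; $\mu_n(b_k,\lambda_k)$ denotes $\mathcal L(x^n)$, where $\mathcal L$ is the unique linear functional on polynomials with $\mathcal L(1)=1$ and $\mathcal L(p_m)=0$ for all $m\ge1$. $(a)_m=a(a+1)\cdots(a+m-1)$, $(a)_0=1$. -}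

module Defs where

open import Data.Nat using (ℕ; zero; suc; _∸_; _!)
open import Data.Nat.Properties using (_!≢0)
open import Data.Integer using (+_)
open import Data.Rational using (ℚ; 0ℚ; 1ℚ; _+_; _*_; -_; _-_; _/_)
open import Data.List using (List; []; _∷_)
open import Data.Product using (_×_; _,_; proj₁)

-- Polynomials over ℚ as coefficient lists, lowest degree first.
Poly : Set
Poly = List ℚ

_⊕_ : Poly → Poly → Poly
[] ⊕ q = q
(a ∷ p) ⊕ [] = a ∷ p
(a ∷ p) ⊕ (b ∷ q) = (a + b) ∷ (p ⊕ q)

_·_ : ℚ → Poly → Poly
c · [] = []
c · (a ∷ p) = (c * a) ∷ (c · p)

shiftX : Poly → Poly
shiftX p = 0ℚ ∷ p

-- the pair (p_n , p_{n-1}) for the three-term recurrence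
-- p_{-1}=0, p_0=1, p_{n+1} = (x - b_n) p_n - λ_n p_{n-1}
opPair : (ℕ → ℚ) → (ℕ → ℚ) → ℕ → Poly × Poly
opPair b λ' zero = (1ℚ ∷ [] , [])
opPair b λ' (suc n) with opPair b λ' n
... | (pn , pn-1) = ((shiftX pn ⊕ ((- b n) · pn)) ⊕ ((- λ' n) · pn-1) , pn)

opoly : (ℕ → ℚ) → (ℕ → ℚ) → ℕ → Poly
opoly b λ' n = proj₁ (opPair b λ' n)

-- apply the linear functional with values m i = L(x^i) to a polynomial
applyL : (ℕ → ℚ) → Poly → ℚ
applyL m [] = 0ℚ
applyL m (a ∷ p) = a * m 0 + applyL (λ i → m (suc i)) p

-- m is the moment sequence μ_n(b_k, λ_k): m n = L(x^n) where L is the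
-- linear functional with L(1) = 1 and L(p_n) = 0 for n ≥ 1.
-- (L is determined by its values on monomials; such m is unique.)
IsMoments : (ℕ → ℚ) → (ℕ → ℚ) → (ℕ → ℚ) → Set
IsMoments b λ' m = (m 0 ≡ 1ℚ) × (∀ n → applyL m (opoly b λ' (suc n)) ≡ 0ℚ)
  where open import Relation.Binary.PropositionalEquality using (_≡_)

poch : ℚ → ℕ → ℚ
poch a zero = 1ℚ
poch a (suc m) = poch a m * (a + (+ m) / 1)

invFact : ℕ → ℚ
invFact n = _/_ (+ 1) (n !) {{n !≢0}}

ℕtoℚ : ℕ → ℚ
ℕtoℚ n = (+ n) / 1

sumTo : ℕ → (ℕ → ℚ) → ℚ
sumTo zero f = f 0
sumTo (suc J) f = sumTo J f + f (suc J)

bθ : ℚ → ℚ → ℕ → ℚ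
bθ X Y k = ℕtoℚ (2 Data.Nat.* k) + X + Y

λθ : ℚ → ℚ → ℕ → ℚ
λθ X Y k = (ℕtoℚ k + X) * (ℕtoℚ k - 1ℚ + Y)

-- Write g(n, k) = L(xⁿ pₖ).  The three-term recurrence x pₖ = pₖ₊₁ + bₖ pₖ + λₖ pₖ₋₁ gives
-- g(n+1, k) = g(n, k+1) + bₖ g(n, k) + λₖ g(n, k−1), and orthogonality gives g(0, k) = δₖ₀.
-- Hence the convolution G(J, k) = Σₙ g(n, k) c(J−n) with any kernel c satisfies
-- G(J+1, k) = δₖ₀ c(J+1) + G(J, k+1) + bₖ G(J, k) + λₖ G(J, k−1) and G(0, k) = δₖ₀ c(0),
-- which determines it.  For c(j) = (Y−1)ⱼ (X)ⱼ / j! the family (Y)_J (X+1)_J / (J−k)! obeys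
-- the same recursion, by two polynomial identities, so the two agree; k = 0 is the theorem.
module Submission where

open import Defs
open import Data.Nat using (ℕ; _∸_)
open import Data.Rational using (ℚ; _+_; _*_; _-_; 1ℚ)
open import Relation.Binary.PropositionalEquality using (_≡_)

open import Data.Nat as ℕ using (zero; suc; pred; _!; _<_; _≤?_)
import Data.Nat.Properties as ℕP
import Data.Integer as ℤ
import Data.Integer.Properties as ℤP
import Data.Integer.Tactic.RingSolver as ℤ-Solver
open import Data.Rational using (-_; 0ℚ; _/_; _≟_; fromℚᵘ)
import Data.Rational.Properties as ℚP
import Data.Rational.Unnormalised as ℚᵘ
import Data.Rational.Unnormalised.Properties as ℚᵘP
open import Data.List using ([]; _∷_)
open import Data.Product using (_,_; proj₂)
open import Relation.Binary.PropositionalEquality using (refl; sym; trans; cong; cong₂; module ≡-Reasoning)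
open import Relation.Nullary using (Dec; yes; no)
open import Relation.Nullary.Decidable using (dec⇒maybe)
open import Tactic.RingSolver using (solve-∀)
open import Tactic.RingSolver.Core.AlmostCommutativeRing using (AlmostCommutativeRing; fromCommutativeRing)

open ≡-Reasoning

ℚ-ring : AlmostCommutativeRing _ _
ℚ-ring = fromCommutativeRing ℚP.+-*-commutativeRing (λ x → dec⇒maybe (0ℚ ≟ x))

fromℚᵘ-+ : ∀ p q → fromℚᵘ (p ℚᵘ.+ q) ≡ fromℚᵘ p + fromℚᵘ q
fromℚᵘ-+ p q = ℚP.toℚᵘ-injective (ℚᵘP.≃-trans (ℚP.toℚᵘ-fromℚᵘ (p ℚᵘ.+ q))
  (ℚᵘP.≃-sym (ℚᵘP.≃-trans (ℚP.toℚᵘ-homo-+ (fromℚᵘ p) (fromℚᵘ q))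
    (ℚᵘP.+-cong (ℚP.toℚᵘ-fromℚᵘ p) (ℚP.toℚᵘ-fromℚᵘ q)))))

fromℚᵘ-* : ∀ p q → fromℚᵘ (p ℚᵘ.* q) ≡ fromℚᵘ p * fromℚᵘ q
fromℚᵘ-* p q = ℚP.toℚᵘ-injective (ℚᵘP.≃-trans (ℚP.toℚᵘ-fromℚᵘ (p ℚᵘ.* q))
  (ℚᵘP.≃-sym (ℚᵘP.≃-trans (ℚP.toℚᵘ-homo-* (fromℚᵘ p) (fromℚᵘ q))
    (ℚᵘP.*-cong (ℚP.toℚᵘ-fromℚᵘ p) (ℚP.toℚᵘ-fromℚᵘ q)))))

-- ℕtoℚ n is definitionally fromℚᵘ (ℕtoℚᵘ n).
ℕtoℚᵘ : ℕ → ℚᵘ.ℚᵘ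
ℕtoℚᵘ n = ℚᵘ.mkℚᵘ (ℤ.+ n) 0

ℕtoℚ-+ : ∀ m n → ℕtoℚ (m ℕ.+ n) ≡ ℕtoℚ m + ℕtoℚ n
ℕtoℚ-+ m n = trans
  (ℚP.fromℚᵘ-cong {ℕtoℚᵘ (m ℕ.+ n)} {ℕtoℚᵘ m ℚᵘ.+ ℕtoℚᵘ n}
    (ℚᵘ.*≡* (trans (cong (ℤ._* ℤ.1ℤ) (ℤP.pos-+ m n)) (cross-multiplied (ℤ.+ m) (ℤ.+ n)))))
  (fromℚᵘ-+ (ℕtoℚᵘ m) (ℕtoℚᵘ n))
  where
  cross-multiplied : ∀ a b → (a ℤ.+ b) ℤ.* ℤ.1ℤ ≡ (a ℤ.* ℤ.1ℤ ℤ.+ b ℤ.* ℤ.1ℤ) ℤ.* ℤ.1ℤ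
  cross-multiplied = ℤ-Solver.solve-∀

ℕtoℚ-* : ∀ m n → ℕtoℚ (m ℕ.* n) ≡ ℕtoℚ m * ℕtoℚ n
ℕtoℚ-* m n = trans
  (ℚP.fromℚᵘ-cong {ℕtoℚᵘ (m ℕ.* n)} {ℕtoℚᵘ m ℚᵘ.* ℕtoℚᵘ n}
    (ℚᵘ.*≡* (cong (ℤ._* ℤ.1ℤ) (ℤP.pos-* m n))))
  (fromℚᵘ-* (ℕtoℚᵘ m) (ℕtoℚᵘ n))

ℕtoℚ-suc : ∀ n → ℕtoℚ (suc n) ≡ 1ℚ + ℕtoℚ n
ℕtoℚ-suc = ℕtoℚ-+ 1

ℕtoℚ-double : ∀ n → ℕtoℚ (2 ℕ.* n) ≡ ℕtoℚ n + ℕtoℚ n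
ℕtoℚ-double n = trans (ℕtoℚ-+ n (n ℕ.+ 0)) (cong (λ m → ℕtoℚ n + ℕtoℚ m) (ℕP.+-identityʳ n))

1/n*n≡1 : ∀ n .{{_ : ℕ.NonZero n}} → (ℤ.+ 1 / n) * ℕtoℚ n ≡ 1ℚ
1/n*n≡1 (suc n) = trans (sym (fromℚᵘ-* (ℚᵘ.mkℚᵘ (ℤ.+ 1) n) (ℕtoℚᵘ (suc n))))
  (ℚP.fromℚᵘ-cong {ℚᵘ.mkℚᵘ (ℤ.+ 1) n ℚᵘ.* ℕtoℚᵘ (suc n)} {ℕtoℚᵘ 1}
    (ℚᵘ.*≡* (cross-multiplied (ℤ.+ suc n))))
  where
  cross-multiplied : ∀ a → (ℤ.1ℤ ℤ.* a) ℤ.* ℤ.1ℤ ≡ ℤ.1ℤ ℤ.* (a ℤ.* ℤ.1ℤ)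
  cross-multiplied = ℤ-Solver.solve-∀

invFact-inverse : ∀ n → invFact n * ℕtoℚ (n !) ≡ 1ℚ
invFact-inverse n = 1/n*n≡1 (n !) {{n ℕP.!≢0}}

invFact-suc : ∀ m → invFact m ≡ ℕtoℚ (suc m) * invFact (suc m)
invFact-suc m = begin
  a                              ≡⟨ ℚP.*-identityʳ a ⟨
  a * 1ℚ                         ≡⟨ cong (a *_) (invFact-inverse (suc m)) ⟨
  a * (f * ℕtoℚ (suc m ℕ.* m !)) ≡⟨ cong (λ x → a * (f * x)) (ℕtoℚ-* (suc m) (m !)) ⟩
  a * (f * (s * ℕtoℚ (m !)))     ≡⟨ regroup a f s (ℕtoℚ (m !)) ⟩
  s * f * (a * ℕtoℚ (m !))       ≡⟨ cong ((s * f) *_) (invFact-inverse m) ⟩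
  s * f * 1ℚ                     ≡⟨ ℚP.*-identityʳ (s * f) ⟩
  s * f                          ∎
  where
  a = invFact m
  f = invFact (suc m)
  s = ℕtoℚ (suc m)
  regroup : ∀ a f s c → a * (f * (s * c)) ≡ s * f * (a * c)
  regroup = solve-∀ ℚ-ring

poch-suc : ∀ a m → poch a (suc m) ≡ a * poch (a + 1ℚ) m
poch-suc a zero = solve-zero a
  where
  solve-zero : ∀ a → 1ℚ * (a + 0ℚ) ≡ a * 1ℚ
  solve-zero = solve-∀ ℚ-ring
poch-suc a (suc m) = begin
  poch a (suc m) * (a + ℕtoℚ (suc m))     ≡⟨ cong₂ (λ p j → p * (a + j)) (poch-suc a m) (ℕtoℚ-suc m) ⟩
  a * poch (a + 1ℚ) m * (a + (1ℚ + ℕtoℚ m)) ≡⟨ regroup a (poch (a + 1ℚ) m) (ℕtoℚ m) ⟩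
  a * poch (a + 1ℚ) (suc m)               ∎
  where
  regroup : ∀ a p j → a * p * (a + (1ℚ + j)) ≡ a * (p * ((a + 1ℚ) + j))
  regroup = solve-∀ ℚ-ring

sumTo-cong : ∀ J {f g : ℕ → ℚ} → (∀ n → f n ≡ g n) → sumTo J f ≡ sumTo J g
sumTo-cong zero    f≡g = f≡g 0
sumTo-cong (suc J) f≡g = cong₂ _+_ (sumTo-cong J f≡g) (f≡g (suc J))

sumTo-head : ∀ J f → sumTo (suc J) f ≡ f 0 + sumTo J (λ n → f (suc n))
sumTo-head zero    f = refl
sumTo-head (suc J) f = trans (cong (_+ f (suc (suc J))) (sumTo-head J f))
  (ℚP.+-assoc (f 0) (sumTo J (λ n → f (suc n))) (f (suc (suc J))))

sumTo-+ : ∀ J f g → sumTo J (λ n → f n + g n) ≡ sumTo J f + sumTo J g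
sumTo-+ zero    f g = refl
sumTo-+ (suc J) f g = trans (cong (_+ (f (suc J) + g (suc J))) (sumTo-+ J f g))
  (interchange (sumTo J f) (sumTo J g) (f (suc J)) (g (suc J)))
  where
  interchange : ∀ a b c d → (a + b) + (c + d) ≡ (a + c) + (b + d)
  interchange = solve-∀ ℚ-ring

sumTo-*ˡ : ∀ J a f → sumTo J (λ n → a * f n) ≡ a * sumTo J f
sumTo-*ˡ zero    a f = refl
sumTo-*ˡ (suc J) a f = trans (cong (_+ a * f (suc J)) (sumTo-*ˡ J a f))
  (sym (ℚP.*-distribˡ-+ a (sumTo J f) (f (suc J))))

opolyPrev : (ℕ → ℚ) → (ℕ → ℚ) → ℕ → Poly
opolyPrev b λ' n = proj₂ (opPair b λ' n)

applyL-cong : ∀ {m m'} → (∀ i → m i ≡ m' i) → ∀ p → applyL m p ≡ applyL m' p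
applyL-cong m≡m' []      = refl
applyL-cong m≡m' (a ∷ p) = cong₂ _+_ (cong (a *_) (m≡m' 0)) (applyL-cong (λ i → m≡m' (suc i)) p)

applyL-⊕ : ∀ m p q → applyL m (p ⊕ q) ≡ applyL m p + applyL m q
applyL-⊕ m []      q       = sym (ℚP.+-identityˡ _)
applyL-⊕ m (a ∷ p) []      = sym (ℚP.+-identityʳ _)
applyL-⊕ m (a ∷ p) (b ∷ q) =
  trans (cong (((a + b) * m 0) +_) (applyL-⊕ (λ i → m (suc i)) p q)) (interchange a b (m 0) _ _)
  where
  interchange : ∀ a b x u v → (a + b) * x + (u + v) ≡ (a * x + u) + (b * x + v)
  interchange = solve-∀ ℚ-ring

applyL-· : ∀ m c p → applyL m (c · p) ≡ c * applyL m p
applyL-· m c []      = sym (ℚP.*-zeroʳ c)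
applyL-· m c (a ∷ p) =
  trans (cong ((c * a * m 0) +_) (applyL-· (λ i → m (suc i)) c p)) (factor c a (m 0) _)
  where
  factor : ∀ c a x u → c * a * x + c * u ≡ c * (a * x + u)
  factor = solve-∀ ℚ-ring

applyL-shiftX : ∀ m p → applyL m (shiftX p) ≡ applyL (λ i → m (suc i)) p
applyL-shiftX m p = trans (cong (_+ applyL (λ i → m (suc i)) p) (ℚP.*-zeroˡ (m 0))) (ℚP.+-identityˡ _)

applyL-three-term : ∀ b λ' m k →
  applyL m (shiftX (opoly b λ' k)) ≡
    applyL m (opoly b λ' (suc k)) + b k * applyL m (opoly b λ' k) + λ' k * applyL m (opolyPrev b λ' k)
applyL-three-term b λ' m k = begin
  x                                                  ≡⟨ cancel x (b k) y (λ' k) z ⟩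
  x + - b k * y + - λ' k * z + b k * y + λ' k * z    ≡⟨ cong (λ u → u + b k * y + λ' k * z) expand ⟨
  applyL m (opoly b λ' (suc k)) + b k * y + λ' k * z ∎
  where
  p = opoly b λ' k
  q = opolyPrev b λ' k
  x = applyL m (shiftX p)
  y = applyL m p
  z = applyL m q
  expand : applyL m (opoly b λ' (suc k)) ≡ x + - b k * y + - λ' k * z
  expand = trans (applyL-⊕ m (shiftX p ⊕ ((- b k) · p)) ((- λ' k) · q))
    (cong₂ _+_ (trans (applyL-⊕ m (shiftX p) ((- b k) · p)) (cong (x +_) (applyL-· m (- b k) p)))
               (applyL-· m (- λ' k) q))
  cancel : ∀ x β y l z → x ≡ x + - β * y + - l * z + β * y + l * z
  cancel = solve-∀ ℚ-ring

-- A recursion in (J, k) and its convolution solutions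

record SolvesRecursion (b λ' c : ℕ → ℚ) (G : ℕ → ℕ → ℚ) : Set where
  field
    initial-zero : G 0 0 ≡ c 0
    initial-suc  : ∀ k → G 0 (suc k) ≡ 0ℚ
    step-zero    : ∀ J → G (suc J) 0 ≡ c (suc J) + G J 1 + b 0 * G J 0
    step-suc     : ∀ J k →
      G (suc J) (suc k) ≡ G J (suc (suc k)) + b (suc k) * G J (suc k) + λ' (suc k) * G J k

solutions-unique : ∀ {b λ' c G H} → SolvesRecursion b λ' c G → SolvesRecursion b λ' c H →
  ∀ J k → G J k ≡ H J k
solutions-unique {b} {λ'} {c} {G} {H} sG sH = go
  where
  module G = SolvesRecursion sG
  module H = SolvesRecursion sH
  go : ∀ J k → G J k ≡ H J k
  go zero    zero    = trans G.initial-zero (sym H.initial-zero)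
  go zero    (suc k) = trans (G.initial-suc k) (sym (H.initial-suc k))
  go (suc J) zero    = begin
    G (suc J) 0                        ≡⟨ G.step-zero J ⟩
    c (suc J) + G J 1 + b 0 * G J 0    ≡⟨ cong₂ (λ u v → c (suc J) + u + b 0 * v) (go J 1) (go J 0) ⟩
    c (suc J) + H J 1 + b 0 * H J 0    ≡⟨ H.step-zero J ⟨
    H (suc J) 0                        ∎
  go (suc J) (suc k) = begin
    G (suc J) (suc k)
      ≡⟨ G.step-suc J k ⟩
    G J (suc (suc k)) + b (suc k) * G J (suc k) + λ' (suc k) * G J k
      ≡⟨ cong₂ (λ u v → u + b (suc k) * v + λ' (suc k) * G J k) (go J (suc (suc k))) (go J (suc k)) ⟩
    H J (suc (suc k)) + b (suc k) * H J (suc k) + λ' (suc k) * G J k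
      ≡⟨ cong (λ w → H J (suc (suc k)) + b (suc k) * H J (suc k) + λ' (suc k) * w) (go J k) ⟩
    H J (suc (suc k)) + b (suc k) * H J (suc k) + λ' (suc k) * H J k
      ≡⟨ H.step-suc J k ⟨
    H (suc J) (suc k)
      ∎

module Convolution (b λ' θ c : ℕ → ℚ) where

  shiftedMoments : ℕ → ℕ → ℚ
  shiftedMoments n i = θ (n ℕ.+ i)

  mixedMoment : ℕ → ℕ → ℚ
  mixedMoment n k = applyL (shiftedMoments n) (opoly b λ' k)

  mixedMomentPrev : ℕ → ℕ → ℚ
  mixedMomentPrev n k = applyL (shiftedMoments n) (opolyPrev b λ' k)

  conv : ℕ → ℕ → ℚ
  conv J k = sumTo J (λ n → mixedMoment n k * c (J ∸ n))

  convPrev : ℕ → ℕ → ℚ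
  convPrev J k = sumTo J (λ n → mixedMomentPrev n k * c (J ∸ n))

  mixedMoment-zero : ∀ n → mixedMoment n 0 ≡ θ n
  mixedMoment-zero n = trans (ℚP.+-identityʳ _) (trans (ℚP.*-identityˡ _) (cong θ (ℕP.+-identityʳ n)))

  mixedMoment-suc : ∀ n k →
    mixedMoment (suc n) k ≡ mixedMoment n (suc k) + b k * mixedMoment n k + λ' k * mixedMomentPrev n k
  mixedMoment-suc n k = begin
    mixedMoment (suc n) k
      ≡⟨ applyL-cong (λ i → cong θ (ℕP.+-suc n i)) (opoly b λ' k) ⟨
    applyL (λ i → shiftedMoments n (suc i)) (opoly b λ' k)
      ≡⟨ applyL-shiftX (shiftedMoments n) (opoly b λ' k) ⟨
    applyL (shiftedMoments n) (shiftX (opoly b λ' k))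
      ≡⟨ applyL-three-term b λ' (shiftedMoments n) k ⟩
    mixedMoment n (suc k) + b k * mixedMoment n k + λ' k * mixedMomentPrev n k
      ∎

  conv-suc : ∀ J k → conv (suc J) k ≡
    mixedMoment 0 k * c (suc J) + (conv J (suc k) + b k * conv J k + λ' k * convPrev J k)
  conv-suc J k = trans (sumTo-head J _) (cong (mixedMoment 0 k * c (suc J) +_) (begin
    sumTo J (λ n → mixedMoment (suc n) k * c (J ∸ n))
      ≡⟨ sumTo-cong J term-suc ⟩
    sumTo J (λ n → x n + b k * y n + λ' k * z n)
      ≡⟨ sumTo-+ J (λ n → x n + b k * y n) (λ n → λ' k * z n) ⟩
    sumTo J (λ n → x n + b k * y n) + sumTo J (λ n → λ' k * z n)
      ≡⟨ cong₂ _+_ (trans (sumTo-+ J x (λ n → b k * y n)) (cong (conv J (suc k) +_) (sumTo-*ˡ J (b k) y)))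
                   (sumTo-*ˡ J (λ' k) z) ⟩
    conv J (suc k) + b k * conv J k + λ' k * convPrev J k
      ∎))
    where
    x y z : ℕ → ℚ
    x n = mixedMoment n (suc k) * c (J ∸ n)
    y n = mixedMoment n k * c (J ∸ n)
    z n = mixedMomentPrev n k * c (J ∸ n)
    distrib : ∀ u β v l w γ → (u + β * v + l * w) * γ ≡ u * γ + β * (v * γ) + l * (w * γ)
    distrib = solve-∀ ℚ-ring
    term-suc : ∀ n → mixedMoment (suc n) k * c (J ∸ n) ≡ x n + b k * y n + λ' k * z n
    term-suc n = trans (cong (_* c (J ∸ n)) (mixedMoment-suc n k))
      (distrib (mixedMoment n (suc k)) (b k) (mixedMoment n k) (λ' k) (mixedMomentPrev n k) (c (J ∸ n)))

  conv-solves : IsMoments b λ' θ → SolvesRecursion b λ' c conv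
  conv-solves (θ₀≡1 , orthogonal) = record
    { initial-zero = trans (cong (_* c 0) mixedMoment-0-0) (ℚP.*-identityˡ (c 0))
    ; initial-suc  = λ k → trans (cong (_* c 0) (orthogonal k)) (ℚP.*-zeroˡ (c 0))
    ; step-zero    = step-zero
    ; step-suc     = step-suc
    }
    where
    mixedMoment-0-0 : mixedMoment 0 0 ≡ 1ℚ
    mixedMoment-0-0 = trans (mixedMoment-zero 0) θ₀≡1

    convPrev-zero : ∀ J → convPrev J 0 ≡ 0ℚ
    convPrev-zero J = trans (sumTo-*ˡ J 0ℚ (λ n → c (J ∸ n))) (ℚP.*-zeroˡ (sumTo J (λ n → c (J ∸ n))))

    step-zero : ∀ J → conv (suc J) 0 ≡ c (suc J) + conv J 1 + b 0 * conv J 0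
    step-zero J = begin
      conv (suc J) 0
        ≡⟨ conv-suc J 0 ⟩
      mixedMoment 0 0 * c (suc J) + (conv J 1 + b 0 * conv J 0 + λ' 0 * convPrev J 0)
        ≡⟨ cong₂ (λ u v → u * c (suc J) + (conv J 1 + b 0 * conv J 0 + λ' 0 * v))
             mixedMoment-0-0 (convPrev-zero J) ⟩
      1ℚ * c (suc J) + (conv J 1 + b 0 * conv J 0 + λ' 0 * 0ℚ)
        ≡⟨ simplify (c (suc J)) (conv J 1) (b 0) (conv J 0) (λ' 0) ⟩
      c (suc J) + conv J 1 + b 0 * conv J 0
        ∎
      where
      simplify : ∀ a u β v l → 1ℚ * a + (u + β * v + l * 0ℚ) ≡ a + u + β * v
      simplify = solve-∀ ℚ-ring

    step-suc : ∀ J k → conv (suc J) (suc k) ≡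
      conv J (suc (suc k)) + b (suc k) * conv J (suc k) + λ' (suc k) * conv J k
    step-suc J k = begin
      conv (suc J) (suc k)                     ≡⟨ conv-suc J (suc k) ⟩
      mixedMoment 0 (suc k) * c (suc J) + rest ≡⟨ cong (λ u → u * c (suc J) + rest) (orthogonal k) ⟩
      0ℚ * c (suc J) + rest                    ≡⟨ cong (_+ rest) (ℚP.*-zeroˡ (c (suc J))) ⟩
      0ℚ + rest                                ≡⟨ ℚP.+-identityˡ rest ⟩
      rest                                     ∎
      where
      rest = conv J (suc (suc k)) + b (suc k) * conv J (suc k) + λ' (suc k) * conv J k

-- The closed form

-- invFactGap J k is 1/(J − k)! for k ≤ J and 0 for k > J.
invFactGap : ℕ → ℕ → ℚ
invFactGap J       zero    = invFact J
invFactGap zero    (suc k) = 0ℚ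
invFactGap (suc J) (suc k) = invFactGap J k

-- Valid for every k: once k ≥ J both sides vanish.
invFactGap-suc : ∀ J k → invFactGap J (suc k) ≡ ℕtoℚ (J ∸ k) * invFactGap J k
invFactGap-suc zero    zero    = refl
invFactGap-suc (suc J) zero    = invFact-suc J
invFactGap-suc zero    (suc k) = refl
invFactGap-suc (suc J) (suc k) = invFactGap-suc J k

invFactGap-beyond : ∀ {J k} → J < k → invFactGap J k ≡ 0ℚ
invFactGap-beyond {zero}  {suc k} _             = refl
invFactGap-beyond {suc J} {suc k} (ℕ.s≤s J<k) = invFactGap-beyond J<k

ℕtoℚ-pred-* : ∀ r x → ℕtoℚ (pred r) * (ℕtoℚ r * x) ≡ (ℕtoℚ r - 1ℚ) * (ℕtoℚ r * x)
ℕtoℚ-pred-* zero    x = at-zero x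
  where
  at-zero : ∀ x → 0ℚ * (0ℚ * x) ≡ (0ℚ - 1ℚ) * (0ℚ * x)
  at-zero = solve-∀ ℚ-ring
ℕtoℚ-pred-* (suc r) x = cong (_* (ℕtoℚ (suc r) * x))
  (trans (cancel (ℕtoℚ r)) (cong (_- 1ℚ) (sym (ℕtoℚ-suc r))))
  where
  cancel : ∀ j → j ≡ (1ℚ + j) - 1ℚ
  cancel = solve-∀ ℚ-ring

module ClosedForm (X Y : ℚ) where

  kernel : ℕ → ℚ
  kernel j = poch (Y - 1ℚ) j * poch X j * invFact j

  prefactor : ℕ → ℚ
  prefactor J = poch Y J * poch (X + 1ℚ) J

  closed : ℕ → ℕ → ℚ
  closed J k = prefactor J * invFactGap J k

  prefactor-suc : ∀ J → prefactor (suc J) ≡ prefactor J * ((Y + ℕtoℚ J) * (X + 1ℚ + ℕtoℚ J))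
  prefactor-suc J = regroup (poch Y J) (poch (X + 1ℚ) J) (Y + ℕtoℚ J) (X + 1ℚ + ℕtoℚ J)
    where
    regroup : ∀ p q u v → p * u * (q * v) ≡ p * q * (u * v)
    regroup = solve-∀ ℚ-ring

  kernel-suc : ∀ J → kernel (suc J) ≡ prefactor J * ((Y - 1ℚ) * X) * invFact (suc J)
  kernel-suc J = begin
    poch (Y - 1ℚ) (suc J) * poch X (suc J) * f
      ≡⟨ cong₂ (λ u v → u * v * f) (poch-suc (Y - 1ℚ) J) (poch-suc X J) ⟩
    (Y - 1ℚ) * poch (Y - 1ℚ + 1ℚ) J * (X * poch (X + 1ℚ) J) * f
      ≡⟨ cong (λ y → (Y - 1ℚ) * poch y J * (X * poch (X + 1ℚ) J) * f) (cancel Y) ⟩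
    (Y - 1ℚ) * poch Y J * (X * poch (X + 1ℚ) J) * f
      ≡⟨ regroup (Y - 1ℚ) (poch Y J) X (poch (X + 1ℚ) J) f ⟩
    prefactor J * ((Y - 1ℚ) * X) * f
      ∎
    where
    f = invFact (suc J)
    cancel : ∀ y → y - 1ℚ + 1ℚ ≡ y
    cancel = solve-∀ ℚ-ring
    regroup : ∀ a p x q f → a * p * (x * q) * f ≡ p * q * (a * x) * f
    regroup = solve-∀ ℚ-ring

  invFactGap-step : ∀ J k →
    (Y + ℕtoℚ J) * (X + 1ℚ + ℕtoℚ J) * invFactGap J k ≡
      invFactGap J (suc (suc k)) + bθ X Y (suc k) * invFactGap J (suc k) + λθ X Y (suc k) * invFactGap J k
  invFactGap-step J k = begin
    (Y + Ĵ) * (X + 1ℚ + Ĵ) * d             ≡⟨ split (k ≤? J) ⟩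
    ŝ * (r̂ * d) + β * (r̂ * d) + l * d      ≡⟨ cong₂ (λ u v → u + β * v + l * d) d₂ d₁ ⟨
    invFactGap J (suc (suc k)) + β * invFactGap J (suc k) + l * d ∎
    where
    Ĵ = ℕtoℚ J
    r̂ = ℕtoℚ (J ∸ k)
    ŝ = ℕtoℚ (J ∸ suc k)
    d = invFactGap J k
    β = bθ X Y (suc k)
    l = λθ X Y (suc k)
    κ = ℕtoℚ (suc k)

    d₁ : invFactGap J (suc k) ≡ r̂ * d
    d₁ = invFactGap-suc J k

    d₂ : invFactGap J (suc (suc k)) ≡ ŝ * (r̂ * d)
    d₂ = trans (invFactGap-suc J (suc k)) (cong (ŝ *_) d₁)

    -- k and r stand for ℕtoℚ k and ℕtoℚ (J ∸ k); for k ≤ J, J = k + r.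
    identity : ∀ X Y k r d →
      (Y + (k + r)) * (X + 1ℚ + (k + r)) * d ≡
        (r - 1ℚ) * (r * d) + ((1ℚ + k) + (1ℚ + k) + X + Y) * (r * d) + ((1ℚ + k) + X) * ((1ℚ + k) - 1ℚ + Y) * d
    identity = solve-∀ ℚ-ring

    vanish : ∀ a s r β l → a * 0ℚ ≡ s * (r * 0ℚ) + β * (r * 0ℚ) + l * 0ℚ
    vanish = solve-∀ ℚ-ring

    split : Dec (k ℕ.≤ J) → (Y + Ĵ) * (X + 1ℚ + Ĵ) * d ≡ ŝ * (r̂ * d) + β * (r̂ * d) + l * d
    split (yes k≤J) = begin
      (Y + Ĵ) * (X + 1ℚ + Ĵ) * d
        ≡⟨ cong (λ j → (Y + j) * (X + 1ℚ + j) * d)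
             (trans (cong ℕtoℚ (sym (ℕP.m+[n∸m]≡n k≤J))) (ℕtoℚ-+ k (J ∸ k))) ⟩
      (Y + (ℕtoℚ k + r̂)) * (X + 1ℚ + (ℕtoℚ k + r̂)) * d
        ≡⟨ identity X Y (ℕtoℚ k) r̂ d ⟩
      (r̂ - 1ℚ) * (r̂ * d) + ((1ℚ + ℕtoℚ k) + (1ℚ + ℕtoℚ k) + X + Y) * (r̂ * d)
        + ((1ℚ + ℕtoℚ k) + X) * ((1ℚ + ℕtoℚ k) - 1ℚ + Y) * d
        ≡⟨ cong₂ (λ u κ → u + (κ + κ + X + Y) * (r̂ * d) + (κ + X) * (κ - 1ℚ + Y) * d)
             (sym ŝr̂≡) (sym (ℕtoℚ-suc k)) ⟩
      ŝ * (r̂ * d) + (κ + κ + X + Y) * (r̂ * d) + l * d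
        ≡⟨ cong (λ t → ŝ * (r̂ * d) + (t + X + Y) * (r̂ * d) + l * d) (ℕtoℚ-double (suc k)) ⟨
      ŝ * (r̂ * d) + β * (r̂ * d) + l * d
        ∎
      where
      ŝr̂≡ : ŝ * (r̂ * d) ≡ (r̂ - 1ℚ) * (r̂ * d)
      ŝr̂≡ = trans (cong (λ s → ℕtoℚ s * (r̂ * d)) (sym (ℕP.pred[m∸n]≡m∸[1+n] J k))) (ℕtoℚ-pred-* (J ∸ k) d)
    split (no k≰J) = begin
      (Y + Ĵ) * (X + 1ℚ + Ĵ) * d                ≡⟨ cong ((Y + Ĵ) * (X + 1ℚ + Ĵ) *_) d≡0 ⟩
      (Y + Ĵ) * (X + 1ℚ + Ĵ) * 0ℚ               ≡⟨ vanish ((Y + Ĵ) * (X + 1ℚ + Ĵ)) ŝ r̂ β l ⟩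
      ŝ * (r̂ * 0ℚ) + β * (r̂ * 0ℚ) + l * 0ℚ     ≡⟨ cong (λ e → ŝ * (r̂ * e) + β * (r̂ * e) + l * e) d≡0 ⟨
      ŝ * (r̂ * d) + β * (r̂ * d) + l * d        ∎
      where
      d≡0 : d ≡ 0ℚ
      d≡0 = invFactGap-beyond (ℕP.≰⇒> k≰J)

  closed-solves : SolvesRecursion (bθ X Y) (λθ X Y) kernel closed
  closed-solves = record
    { initial-zero = refl
    ; initial-suc  = λ k → refl
    ; step-zero    = step-zero
    ; step-suc     = step-suc
    }
    where
    step-zero : ∀ J → closed (suc J) 0 ≡ kernel (suc J) + closed J 1 + bθ X Y 0 * closed J 0
    step-zero J = begin
      prefactor (suc J) * f
        ≡⟨ cong (_* f) (prefactor-suc J) ⟩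
      P * ((Y + Ĵ) * (X + 1ℚ + Ĵ)) * f
        ≡⟨ identity X Y P Ĵ f ⟩
      P * ((Y - 1ℚ) * X) * f + P * (Ĵ * ((1ℚ + Ĵ) * f)) + (0ℚ + X + Y) * (P * ((1ℚ + Ĵ) * f))
        ≡⟨ cong₂ (λ u v → u + P * (Ĵ * v) + bθ X Y 0 * (P * v)) (kernel-suc J) invFact≡ ⟨
      kernel (suc J) + P * (Ĵ * invFact J) + bθ X Y 0 * closed J 0
        ≡⟨ cong (λ u → kernel (suc J) + P * u + bθ X Y 0 * closed J 0) (invFactGap-suc J 0) ⟨
      kernel (suc J) + closed J 1 + bθ X Y 0 * closed J 0
        ∎
      where
      P = prefactor J
      Ĵ = ℕtoℚ J
      f = invFact (suc J)
      invFact≡ : invFact J ≡ (1ℚ + Ĵ) * f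
      invFact≡ = trans (invFact-suc J) (cong (_* f) (ℕtoℚ-suc J))
      identity : ∀ X Y P j f →
        P * ((Y + j) * (X + 1ℚ + j)) * f ≡
          P * ((Y - 1ℚ) * X) * f + P * (j * ((1ℚ + j) * f)) + (0ℚ + X + Y) * (P * ((1ℚ + j) * f))
      identity = solve-∀ ℚ-ring

    step-suc : ∀ J k → closed (suc J) (suc k) ≡
      closed J (suc (suc k)) + bθ X Y (suc k) * closed J (suc k) + λθ X Y (suc k) * closed J k
    step-suc J k = begin
      prefactor (suc J) * g₀                  ≡⟨ cong (_* g₀) (prefactor-suc J) ⟩
      P * ((Y + Ĵ) * (X + 1ℚ + Ĵ)) * g₀       ≡⟨ ℚP.*-assoc P ((Y + Ĵ) * (X + 1ℚ + Ĵ)) g₀ ⟩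
      P * ((Y + Ĵ) * (X + 1ℚ + Ĵ) * g₀)       ≡⟨ cong (P *_) (invFactGap-step J k) ⟩
      P * (g₂ + β * g₁ + l * g₀)              ≡⟨ distribute P g₂ β g₁ l g₀ ⟩
      P * g₂ + β * (P * g₁) + l * (P * g₀)    ∎
      where
      P = prefactor J
      Ĵ = ℕtoℚ J
      β = bθ X Y (suc k)
      l = λθ X Y (suc k)
      g₀ = invFactGap J k
      g₁ = invFactGap J (suc k)
      g₂ = invFactGap J (suc (suc k))
      distribute : ∀ p u β v l w → p * (u + β * v + l * w) ≡ p * u + β * (p * v) + l * (p * w)
      distribute = solve-∀ ℚ-ring

proposition5p1 : (X Y : ℚ) (θ : ℕ → ℚ) → IsMoments (bθ X Y) (λθ X Y) θ →
    (J : ℕ) →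
    sumTo J (λ k → θ k * (poch (Y - 1ℚ) (J ∸ k) * poch X (J ∸ k) * invFact (J ∸ k)))
      ≡ poch Y J * poch (X + 1ℚ) J * invFact J
proposition5p1 X Y θ θ-moments J = begin
  sumTo J (λ n → θ n * kernel (J ∸ n))  ≡⟨ sumTo-cong J (λ n → cong (_* kernel (J ∸ n)) (mixedMoment-zero n)) ⟨
  conv J 0                              ≡⟨ solutions-unique (conv-solves θ-moments) closed-solves J 0 ⟩
  closed J 0                            ∎
  where
  open ClosedForm X Y
  open Convolution (bθ X Y) (λθ X Y) θ kernel
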